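{- For the regular tessellation $\mathcal T=(6^3)$ of the plane by regular hexagons, the half-domination density equals $$\rho_{(6^3)}=\frac{2}{3}.$$
   Context: The tessellation $(6^3)$ is the edge-to-edge tiling of the plane by congruent regular hexagons; it is periodic: a single hexagon translated by all integer combinations of two vectors $v_1,v_2$ (joining the centers of two pairs of adjacent hexagons at angle $60^\circ$) tiles the plane. For $m,n\in\mathbb N$, let $G_{\mathcal T,m,n}$ be the graph whose vertices are the hexagons $H+a v_1+b v_2$, $0\le a<m$, $0\le b<n$ (a rhombic $m$-by-$n$ region), two hexagons being adjacent iff they share a common edge. For a vertex $v$ let $d(v)$ be its degree. A set $S$ of vertices is half-dependent if every $v\in S$ has at most $\lfloor d(v)/2\rfloor$ neighbors in $S$. Let $\rho_{\mathcal T,m,n}$ be the maximum cardinality of a half-dependent set in $G_{\mathcal T,m,n}$ divided by the number of vertices of $G_{\mathcal T,m,n}$, and define the half-domination density $\rho_{\mathcal T}=\limsup_{m,n\to\infty}\rho_{\mathcal T,m,n}$. -}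

module Defs where

open import Data.Nat using (ℕ; zero; suc; _+_; _*_; _<_; _≤_; _/_; _<ᵇ_)
open import Data.Bool using (Bool; true; false; if_then_else_; _∧_)
open import Data.Product using (_×_; _,_)
open import Data.List using (List; []; _∷_)
open import Relation.Binary.PropositionalEquality using (_≡_)

-- Hexagon H + a v₁ + b v₂ is encoded by (a , b).  Two hexagons share an
-- edge iff their coordinate difference is one of
-- ±(1,0), ±(0,1), ±(1,-1)   (v₁, v₂, v₁ - v₂ have the common length
-- of adjacent centres; v₁ + v₂ is longer).

hexNeighbours : ℕ → ℕ → List (ℕ × ℕ)
hexNeighbours a b =
  (suc a , b) ∷ (a , suc b) ∷ (minus a b)
  where
  minus : ℕ → ℕ → List (ℕ × ℕ)
  minus zero    zero    = []
  minus zero    (suc b') = (zero , b') ∷ (suc zero , b') ∷ []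
  minus (suc a') zero    = (a' , zero) ∷ (a' , suc zero) ∷ []
  minus (suc a') (suc b') =
    (suc a' , b') ∷ (suc (suc a') , b') ∷ (a' , suc b') ∷ (a' , suc (suc b')) ∷ []

inRegion : ℕ → ℕ → ℕ × ℕ → Bool
inRegion m n (x , y) = (x <ᵇ m) ∧ (y <ᵇ n)

countL : {A : Set} → (A → Bool) → List A → ℕ
countL p [] = 0
countL p (x ∷ xs) = (if p x then 1 else 0) + countL p xs

-- A vertex set S of G_{T,m,n}: only the values S a b with a < m, b < n matter.
VSet : Set
VSet = ℕ → ℕ → Bool

degree : ℕ → ℕ → ℕ → ℕ → ℕ
degree m n a b = countL (inRegion m n) (hexNeighbours a b)

nbrsIn : ℕ → ℕ → VSet → ℕ → ℕ → ℕ
nbrsIn m n S a b =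
  countL (λ { (x , y) → inRegion m n (x , y) ∧ S x y }) (hexNeighbours a b)

countBelow : (ℕ → Bool) → ℕ → ℕ
countBelow f zero = 0
countBelow f (suc k) = countBelow f k + (if f k then 1 else 0)

card : ℕ → ℕ → VSet → ℕ
card m n S = sumA m
  where
  sumA : ℕ → ℕ
  sumA zero = 0
  sumA (suc a) = sumA a + countBelow (S a) n

HalfDependent : ℕ → ℕ → VSet → Set
HalfDependent m n S =
  ∀ a b → a < m → b < n → S a b ≡ true →
    nbrsIn m n S a b ≤ degree m n a b / 2

module Submission where

-- Upper bound.  Let N(v) be the number of neighbours of v in S.  A hexagon of S has at most
-- three neighbours in S and any hexagon has at most six, so N(v) + 3 [v ∈ S] ≤ 6.  Summed over
-- the m × n region, Σ N(v) splits into six sums, one per edge direction, and each is |S| up to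
-- the hexagons whose neighbour in that direction leaves the region; so
-- 6 |S| − 4 (m + n) + 3 |S| ≤ 6 m n, that is ρ ≤ 2/3 + O(1/m + 1/n).
--
-- Lower bound.  In the (3k+2) × (3k+2) region take S = {(a, b) : 1 ≤ a, b ≤ 3k, a ≢ b mod 3}.
-- Each of these hexagons has all six neighbours in the region, and exactly three of them lie
-- in S; and |S| = 3k · 2k, so the density tends to 2/3.

open import Defs
open import Data.Bool using (Bool; true; false; if_then_else_; _∧_; T)
open import Data.Bool.Properties using (T-∧; T-≡)
open import Data.Empty using (⊥-elim)
open import Data.Integer as ℤ using (+[1+_]; +≤+)
import Data.Integer.Properties as ℤ
import Data.Integer.Tactic.RingSolver as ℤ-Solver
open import Data.List using ([]; _∷_; length)
open import Data.List.Relation.Unary.All using (All; []; _∷_)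
open import Data.Nat
open import Data.Nat.Coprimality using (Coprime)
open import Data.Nat.DivMod using (/-monoˡ-≤)
open import Data.Nat.Properties
open import Data.Nat.Tactic.RingSolver using (solve-∀)
open import Data.Product using (_×_; _,_; Σ; proj₁; proj₂)
open import Data.Rational as ℚ using (ℚ; mkℚ; toℚᵘ)
import Data.Rational.Properties as ℚ
open import Data.Rational.Unnormalised as ℚᵘ using (mkℚᵘ; ↥_; ↧_; *≤*)
import Data.Rational.Unnormalised.Properties as ℚᵘ
open import Data.Unit using (tt)
open import Function using (_∘_; _$_)
open import Function.Bundles using (Equivalence)
open import Relation.Binary.PropositionalEquality

open Equivalence using (to; from)

-- Finite sums

sumBelow : (ℕ → ℕ) → ℕ → ℕ
sumBelow f zero    = 0
sumBelow f (suc k) = sumBelow f k + f k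

sumBelow-cong : ∀ {f g} k → (∀ x → x < k → f x ≡ g x) → sumBelow f k ≡ sumBelow g k
sumBelow-cong zero    f≡g = refl
sumBelow-cong (suc k) f≡g =
  cong₂ _+_ (sumBelow-cong k (λ x x<k → f≡g x (m<n⇒m<1+n x<k))) (f≡g k ≤-refl)

sumBelow-mono-≤ : ∀ {f g} k → (∀ x → x < k → f x ≤ g x) → sumBelow f k ≤ sumBelow g k
sumBelow-mono-≤ zero    f≤g = z≤n
sumBelow-mono-≤ (suc k) f≤g =
  +-mono-≤ (sumBelow-mono-≤ k (λ x x<k → f≤g x (m<n⇒m<1+n x<k))) (f≤g k ≤-refl)

sumBelow-+ : ∀ f g k → sumBelow (λ x → f x + g x) k ≡ sumBelow f k + sumBelow g k
sumBelow-+ f g zero    = refl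
sumBelow-+ f g (suc k) rewrite sumBelow-+ f g k = +-swap (sumBelow f k) (sumBelow g k) (f k) (g k)
  where
  +-swap : ∀ a b c d → a + b + (c + d) ≡ a + c + (b + d)
  +-swap = solve-∀

sumBelow-*ˡ : ∀ c f k → sumBelow (λ x → c * f x) k ≡ c * sumBelow f k
sumBelow-*ˡ c f zero    = sym (*-zeroʳ c)
sumBelow-*ˡ c f (suc k) rewrite sumBelow-*ˡ c f k = sym (*-distribˡ-+ c (sumBelow f k) (f k))

sumBelow-const : ∀ c k → sumBelow (λ _ → c) k ≡ k * c
sumBelow-const c zero    = refl
sumBelow-const c (suc k) rewrite sumBelow-const c k = +-comm (k * c) c

sumBelow-zero : ∀ k → sumBelow (λ _ → 0) k ≡ 0
sumBelow-zero k = trans (sumBelow-const 0 k) (*-zeroʳ k)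

sumBelow-≤-* : ∀ {f} B k → (∀ x → x < k → f x ≤ B) → sumBelow f k ≤ k * B
sumBelow-≤-* B k f≤B = subst (_ ≤_) (sumBelow-const B k) (sumBelow-mono-≤ k f≤B)

sumBelow-shift : ∀ f k → sumBelow (f ∘ suc) k + f 0 ≡ sumBelow f k + f k
sumBelow-shift f zero    = refl
sumBelow-shift f (suc k) =
  trans (+-swap (sumBelow (f ∘ suc) k) (f (suc k)) (f 0)) (cong (_+ f (suc k)) (sumBelow-shift f k))
  where
  +-swap : ∀ a b c → a + b + c ≡ a + c + b
  +-swap = solve-∀

sumBelow-interior : ∀ g k → g 0 ≡ 0 → g (suc k) ≡ 0 → sumBelow g (suc (suc k)) ≡ sumBelow (g ∘ suc) k
sumBelow-interior g k g0≡0 gk≡0 = begin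
  sumBelow g k + g k + g (suc k)   ≡⟨ cong (sumBelow g k + g k +_) gk≡0 ⟩
  sumBelow g k + g k + 0           ≡⟨ +-identityʳ _ ⟩
  sumBelow g k + g k               ≡⟨ sumBelow-shift g k ⟨
  sumBelow (g ∘ suc) k + g 0       ≡⟨ cong (sumBelow (g ∘ suc) k +_) g0≡0 ⟩
  sumBelow (g ∘ suc) k + 0         ≡⟨ +-identityʳ _ ⟩
  sumBelow (g ∘ suc) k             ∎
  where open ≡-Reasoning

-- f at x − 1, and 0 at x = 0: nothing lies left of the region.
atPred : (ℕ → ℕ) → ℕ → ℕ
atPred f zero    = 0
atPred f (suc x) = f x

sumBelow-atPred : ∀ f k → sumBelow (atPred f) (suc k) ≡ sumBelow f k
sumBelow-atPred f zero    = refl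
sumBelow-atPred f (suc k) = cong (_+ f k) (sumBelow-atPred f k)

sumBelow-≤-suc : ∀ {f} B k → f 0 ≤ B → sumBelow f k ≤ sumBelow (f ∘ suc) k + B
sumBelow-≤-suc {f} B k f0≤B = begin
  sumBelow f k                ≤⟨ m≤m+n (sumBelow f k) (f k) ⟩
  sumBelow f k + f k          ≡⟨ sumBelow-shift f k ⟨
  sumBelow (f ∘ suc) k + f 0  ≤⟨ +-monoʳ-≤ (sumBelow (f ∘ suc) k) f0≤B ⟩
  sumBelow (f ∘ suc) k + B    ∎
  where open ≤-Reasoning

sumBelow-≤-atPred : ∀ {f} B k → (∀ x → f x ≤ B) → sumBelow f k ≤ sumBelow (atPred f) k + B
sumBelow-≤-atPred     B zero    f≤B = z≤n
sumBelow-≤-atPred {f} B (suc k) f≤B = begin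
  sumBelow f k + f k                   ≡⟨ cong (_+ f k) (sumBelow-atPred f k) ⟨
  sumBelow (atPred f) (suc k) + f k    ≤⟨ +-monoʳ-≤ (sumBelow (atPred f) (suc k)) (f≤B k) ⟩
  sumBelow (atPred f) (suc k) + B      ∎
  where open ≤-Reasoning

module Box (m n : ℕ) where

  boxSum : (ℕ → ℕ → ℕ) → ℕ
  boxSum f = sumBelow (λ a → sumBelow (f a) n) m

  boxSum-+ : ∀ f g → boxSum (λ a b → f a b + g a b) ≡ boxSum f + boxSum g
  boxSum-+ f g = trans (sumBelow-cong m (λ a _ → sumBelow-+ (f a) (g a) n)) (sumBelow-+ _ _ m)

  boxSum-*ˡ : ∀ c f → boxSum (λ a b → c * f a b) ≡ c * boxSum f
  boxSum-*ˡ c f = trans (sumBelow-cong m (λ a _ → sumBelow-*ˡ c (f a) n)) (sumBelow-*ˡ c _ m)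

  boxSum-zero : boxSum (λ _ _ → 0) ≡ 0
  boxSum-zero = trans (sumBelow-cong m (λ a _ → sumBelow-zero n)) (sumBelow-zero m)

  boxSum-≤-* : ∀ {f} B → (∀ a b → a < m → b < n → f a b ≤ B) → boxSum f ≤ m * (n * B)
  boxSum-≤-* B f≤B = sumBelow-≤-* (n * B) m (λ a a<m → sumBelow-≤-* B n (λ b b<n → f≤B a b a<m b<n))

  -- Translating a 0/1-valued function by one step costs at most one line of the box.
  module _ (g : ℕ → ℕ → ℕ) (g≤1 : ∀ x y → g x y ≤ 1) where

    private
      column≤n : ∀ a → sumBelow (g a) n ≤ n
      column≤n a = ≤-trans (sumBelow-≤-* 1 n (λ b _ → g≤1 a b)) (≤-reflexive (*-identityʳ n))

      columnwise : ∀ {h} → (∀ a → sumBelow (g a) n ≤ sumBelow (h a) n + 1) → boxSum g ≤ boxSum h + m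
      columnwise {h} g≤h+1 = begin
        boxSum g                                     ≤⟨ sumBelow-mono-≤ m (λ a _ → g≤h+1 a) ⟩
        sumBelow (λ a → sumBelow (h a) n + 1) m      ≡⟨ sumBelow-+ _ _ m ⟩
        boxSum h + sumBelow (λ _ → 1) m              ≡⟨ cong (boxSum h +_) (sumBelow-const 1 m) ⟩
        boxSum h + m * 1                             ≡⟨ cong (boxSum h +_) (*-identityʳ m) ⟩
        boxSum h + m                                 ∎
        where open ≤-Reasoning

    boxSum-≤-shiftˣ-suc : boxSum g ≤ boxSum (g ∘ suc) + n
    boxSum-≤-shiftˣ-suc = sumBelow-≤-suc n m (column≤n 0)

    boxSum-≤-shiftˣ-pred : boxSum g ≤ boxSum (λ a b → atPred (λ x → g x b) a) + n
    boxSum-≤-shiftˣ-pred =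
      subst (λ t → boxSum g ≤ t + n) (sumBelow-cong m (λ a _ → columnAtPred a))
        (sumBelow-≤-atPred n m column≤n)
      where
      columnAtPred : ∀ a → atPred (λ x → sumBelow (g x) n) a ≡ sumBelow (λ b → atPred (λ x → g x b) a) n
      columnAtPred zero    = sym (sumBelow-zero n)
      columnAtPred (suc a) = refl

    boxSum-≤-shiftʸ-suc : boxSum g ≤ boxSum (λ a b → g a (suc b)) + m
    boxSum-≤-shiftʸ-suc = columnwise (λ a → sumBelow-≤-suc 1 n (g≤1 a 0))

    boxSum-≤-shiftʸ-pred : boxSum g ≤ boxSum (λ a → atPred (g a)) + m
    boxSum-≤-shiftʸ-pred = columnwise (λ a → sumBelow-≤-atPred 1 n (g≤1 a))

-- Hexagonal neighbourhoods

indicator : Bool → ℕ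
indicator b = if b then 1 else 0

indicator-≤-1 : ∀ b → indicator b ≤ 1
indicator-≤-1 true  = ≤-refl
indicator-≤-1 false = z≤n

indicator-mono : ∀ {b c} → (T b → T c) → indicator b ≤ indicator c
indicator-mono {false}         _   = z≤n
indicator-mono {true} {true}   _   = ≤-refl
indicator-mono {true} {false}  b⇒c = ⊥-elim (b⇒c tt)

countL-≤-length : ∀ {A : Set} (p : A → Bool) xs → countL p xs ≤ length xs
countL-≤-length p []       = z≤n
countL-≤-length p (x ∷ xs) = +-mono-≤ (indicator-≤-1 (p x)) (countL-≤-length p xs)

countL-mono : ∀ {A : Set} {p q : A → Bool} → (∀ x → T (p x) → T (q x)) → ∀ xs → countL p xs ≤ countL q xs
countL-mono p⇒q []       = z≤n
countL-mono p⇒q (x ∷ xs) = +-mono-≤ (indicator-mono (p⇒q x)) (countL-mono p⇒q xs)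

countL-all : ∀ {A : Set} {p : A → Bool} {xs} → All (T ∘ p) xs → countL p xs ≡ length xs
countL-all []         = refl
countL-all (px ∷ all) rewrite to T-≡ px = cong suc (countL-all all)

length-hexNeighbours : ∀ a b → length (hexNeighbours a b) ≤ 6
length-hexNeighbours zero    zero    = s≤s (s≤s z≤n)
length-hexNeighbours zero    (suc b) = s≤s (s≤s (s≤s (s≤s z≤n)))
length-hexNeighbours (suc a) zero    = s≤s (s≤s (s≤s (s≤s z≤n)))
length-hexNeighbours (suc a) (suc b) = ≤-refl

module Region (m n : ℕ) where

  inRegion⁺ : ∀ {x y} → x < m → y < n → T (inRegion m n (x , y))
  inRegion⁺ x<m y<n = from T-∧ (<⇒<ᵇ x<m , <⇒<ᵇ y<n)

  half-degree-≤-3 : ∀ a b → degree m n a b / 2 ≤ 3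
  half-degree-≤-3 a b =
    /-monoˡ-≤ 2 (≤-trans (countL-≤-length (inRegion m n) (hexNeighbours a b)) (length-hexNeighbours a b))

  degree-interior : ∀ {a b} → suc (suc a) < m → suc (suc b) < n → degree m n (suc a) (suc b) ≡ 6
  degree-interior {a} {b} a+2<m b+2<n = countL-all {p = inRegion m n} {xs = hexNeighbours (suc a) (suc b)}
    (inRegion⁺ a+2<m b+1<n ∷ inRegion⁺ a+1<m b+2<n ∷ inRegion⁺ a+1<m b<n ∷
     inRegion⁺ a+2<m b<n ∷ inRegion⁺ a<m b+1<n ∷ inRegion⁺ a<m b+2<n ∷ [])
    where
    a+1<m : suc a < m
    a<m   : a < m
    b+1<n : suc b < n
    b<n   : b < n
    a+1<m = ≤-trans (n≤1+n _) a+2<m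
    a<m   = ≤-trans (n≤1+n _) a+1<m
    b+1<n = ≤-trans (n≤1+n _) b+2<n
    b<n   = ≤-trans (n≤1+n _) b+1<n

countBelow-sumBelow : ∀ f k → countBelow f k ≡ sumBelow (indicator ∘ f) k
countBelow-sumBelow f zero    = refl
countBelow-sumBelow f (suc k) = cong (_+ indicator (f k)) (countBelow-sumBelow f k)

card-sumBelow : ∀ m n S → card m n S ≡ sumBelow (λ a → countBelow (S a) n) m
card-sumBelow zero    n S = refl
card-sumBelow (suc m) n S = cong (_+ countBelow (S m) n) (card-sumBelow m n S)

module UpperBound (m n : ℕ) (S : VSet) where

  open Box m n
  open Region m n

  χ : ℕ → ℕ → ℕ
  χ x y = indicator (inRegion m n (x , y) ∧ S x y)

  χ≤1 : ∀ x y → χ x y ≤ 1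
  χ≤1 x y = indicator-≤-1 _

  χ-inRegion : ∀ {a b} → a < m → b < n → χ a b ≡ indicator (S a b)
  χ-inRegion a<m b<n rewrite to T-≡ (inRegion⁺ a<m b<n) = refl

  right up left down rightDown leftUp : ℕ → ℕ → ℕ
  right     a b = χ (suc a) b
  up        a b = χ a (suc b)
  left      a b = atPred (λ x → χ x b) a
  down      a b = atPred (χ a) b
  rightDown a b = atPred (χ (suc a)) b
  leftUp    a b = atPred (λ x → χ x (suc b)) a

  -- Summands in the order of hexNeighbours, and the trailing + 0, make nbrsIn unfold to this sum.
  neighbourSum : ℕ → ℕ → ℕ
  neighbourSum a b = right a b + (up a b + (down a b + (rightDown a b + (left a b + (leftUp a b + 0)))))

  nbrsIn≡neighbourSum : ∀ a b → nbrsIn m n S a b ≡ neighbourSum a b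
  nbrsIn≡neighbourSum zero    zero    = refl
  nbrsIn≡neighbourSum zero    (suc b) = refl
  nbrsIn≡neighbourSum (suc a) zero    = refl
  nbrsIn≡neighbourSum (suc a) (suc b) = refl

  nbrsIn-≤-6 : ∀ a b → nbrsIn m n S a b ≤ 6
  nbrsIn-≤-6 a b = ≤-trans nbrsIn≤length (length-hexNeighbours a b)
    where
    nbrsIn≤length : nbrsIn m n S a b ≤ length (hexNeighbours a b)
    nbrsIn≤length = countL-≤-length (λ xy → inRegion m n xy ∧ S (proj₁ xy) (proj₂ xy)) (hexNeighbours a b)

  neighbourSum+3χ≤6 : HalfDependent m n S → ∀ a b → a < m → b < n → neighbourSum a b + 3 * χ a b ≤ 6
  neighbourSum+3χ≤6 hd a b a<m b<n
    rewrite sym (nbrsIn≡neighbourSum a b) | χ-inRegion a<m b<n with S a b in a∈S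
  ... | true  = +-monoˡ-≤ 3 (≤-trans (hd a b a<m b<n a∈S) (half-degree-≤-3 a b))
  ... | false = subst (_≤ 6) (sym (+-identityʳ _)) (nbrsIn-≤-6 a b)

  K : ℕ
  K = boxSum χ

  card≡K : card m n S ≡ K
  card≡K = trans (card-sumBelow m n S) (sumBelow-cong m λ a a<m →
    trans (countBelow-sumBelow (S a) n) (sumBelow-cong n λ b b<n → sym (χ-inRegion a<m b<n)))

  boxSum-neighbourSum : boxSum neighbourSum ≡
    boxSum right + (boxSum up + (boxSum down + (boxSum rightDown + (boxSum left + (boxSum leftUp + 0)))))
  boxSum-neighbourSum =
    trans (boxSum-+ right _) $ cong (boxSum right +_) $
    trans (boxSum-+ up _) $ cong (boxSum up +_) $
    trans (boxSum-+ down _) $ cong (boxSum down +_) $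
    trans (boxSum-+ rightDown _) $ cong (boxSum rightDown +_) $
    trans (boxSum-+ left _) $ cong (boxSum left +_) $
    trans (boxSum-+ leftUp _) $ cong (boxSum leftUp +_) boxSum-zero

  6K≤boxSum-neighbourSum : 6 * K ≤ boxSum neighbourSum + 4 * (m + n)
  6K≤boxSum-neighbourSum = begin
    K + (K + (K + (K + (K + (K + 0)))))
      ≤⟨ +-mono-≤ K≤right (+-mono-≤ K≤up (+-mono-≤ K≤down
           (+-mono-≤ K≤rightDown (+-mono-≤ K≤left (+-monoˡ-≤ 0 K≤leftUp))))) ⟩
    (boxSum right + n) + ((boxSum up + m) + ((boxSum down + m) + ((boxSum rightDown + m + n) +
      ((boxSum left + n) + ((boxSum leftUp + n + m) + 0)))))
      ≡⟨ regroup (boxSum right) (boxSum up) (boxSum down) (boxSum rightDown) (boxSum left) (boxSum leftUp) m n ⟩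
    boxSum right + (boxSum up + (boxSum down + (boxSum rightDown + (boxSum left + (boxSum leftUp + 0)))))
      + 4 * (m + n)
      ≡⟨ cong (_+ 4 * (m + n)) boxSum-neighbourSum ⟨
    boxSum neighbourSum + 4 * (m + n) ∎
    where
    open ≤-Reasoning
    K≤right : K ≤ boxSum right + n
    K≤right = boxSum-≤-shiftˣ-suc χ χ≤1
    K≤left : K ≤ boxSum left + n
    K≤left = boxSum-≤-shiftˣ-pred χ χ≤1
    K≤up : K ≤ boxSum up + m
    K≤up = boxSum-≤-shiftʸ-suc χ χ≤1
    K≤down : K ≤ boxSum down + m
    K≤down = boxSum-≤-shiftʸ-pred χ χ≤1
    K≤rightDown : K ≤ boxSum rightDown + m + n
    K≤rightDown = ≤-trans K≤right (+-monoˡ-≤ n (boxSum-≤-shiftʸ-pred right (λ x → χ≤1 (suc x))))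
    K≤leftUp : K ≤ boxSum leftUp + n + m
    K≤leftUp = ≤-trans K≤up (+-monoˡ-≤ m (boxSum-≤-shiftˣ-pred up (λ x y → χ≤1 x (suc y))))
    regroup : ∀ R U D RD L LU m n →
      (R + n) + ((U + m) + ((D + m) + ((RD + m + n) + ((L + n) + ((LU + n + m) + 0)))))
        ≡ R + (U + (D + (RD + (L + (LU + 0))))) + 4 * (m + n)
    regroup = solve-∀

  9K≤6mn+4[m+n] : HalfDependent m n S → 9 * K ≤ 6 * (m * n) + 4 * (m + n)
  9K≤6mn+4[m+n] hd = begin
    9 * K
      ≡⟨ split K ⟩
    6 * K + 3 * K
      ≤⟨ +-monoˡ-≤ (3 * K) 6K≤boxSum-neighbourSum ⟩
    boxSum neighbourSum + 4 * (m + n) + 3 * K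
      ≡⟨ +-comm-last (boxSum neighbourSum) _ _ ⟩
    boxSum neighbourSum + 3 * K + 4 * (m + n)
      ≡⟨ cong (λ t → boxSum neighbourSum + t + 4 * (m + n)) (boxSum-*ˡ 3 χ) ⟨
    boxSum neighbourSum + boxSum (λ a b → 3 * χ a b) + 4 * (m + n)
      ≡⟨ cong (_+ 4 * (m + n)) (boxSum-+ neighbourSum _) ⟨
    boxSum (λ a b → neighbourSum a b + 3 * χ a b) + 4 * (m + n)
      ≤⟨ +-monoˡ-≤ (4 * (m + n)) (boxSum-≤-* 6 (neighbourSum+3χ≤6 hd)) ⟩
    m * (n * 6) + 4 * (m + n)
      ≡⟨ cong (_+ 4 * (m + n)) (reorder m n) ⟩
    6 * (m * n) + 4 * (m + n) ∎
    where
    open ≤-Reasoning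
    split : ∀ K → 9 * K ≡ 6 * K + 3 * K
    split = solve-∀
    +-comm-last : ∀ a b c → a + b + c ≡ a + c + b
    +-comm-last = solve-∀
    reorder : ∀ m n → m * (n * 6) ≡ 6 * (m * n)
    reorder = solve-∀

9card≤6mn+4[m+n] : ∀ m n S → HalfDependent m n S → 9 * card m n S ≤ 6 * (m * n) + 4 * (m + n)
9card≤6mn+4[m+n] m n S hd = subst (λ c → 9 * c ≤ _) (sym card≡K) (9K≤6mn+4[m+n] hd)
  where open UpperBound m n S

-- The periodic construction

data Residue : Set where
  r₀ r₁ r₂ : Residue

residue : ℕ → Residue
residue zero                = r₀
residue (suc zero)          = r₁
residue (suc (suc zero))    = r₂
residue (suc (suc (suc x))) = residue x

next : Residue → Residue
next r₀ = r₁
next r₁ = r₂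
next r₂ = r₀

residue-suc : ∀ x → residue (suc x) ≡ next (residue x)
residue-suc zero                = refl
residue-suc (suc zero)          = refl
residue-suc (suc (suc zero))    = refl
residue-suc (suc (suc (suc x))) = residue-suc x

residue-*3 : ∀ k → residue (k * 3) ≡ r₀
residue-*3 zero    = refl
residue-*3 (suc k) = residue-*3 k

differ : Residue → Residue → Bool
differ r₀ r₀ = false
differ r₁ r₁ = false
differ r₂ r₂ = false
differ _  _  = true

sumBelow-residue : ∀ (f : Residue → ℕ) k → sumBelow (f ∘ residue) (k * 3) ≡ k * (f r₀ + f r₁ + f r₂)
sumBelow-residue f zero    = refl
sumBelow-residue f (suc k)
  rewrite residue-suc (suc (k * 3)) | residue-suc (k * 3) | residue-*3 k | sumBelow-residue f k =
  regroup (f r₀) (f r₁) (f r₂) k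
  where
  regroup : ∀ a b c k → k * (a + b + c) + a + b + c ≡ (a + b + c) + k * (a + b + c)
  regroup = solve-∀

differentResidues : ℕ × ℕ → Bool
differentResidues (x , y) = differ (residue x) (residue y)

-- Along the six edge directions a − b changes by ±1 or ∓2, so three neighbours have
-- a − b ≡ δ + 1 and three have a − b ≡ δ − 1 (mod 3), where δ = a − b; for δ ≢ 0 exactly
-- one of δ ± 1 vanishes.
differingNeighbours : ∀ a b → T (differ (residue (suc a)) (residue (suc b))) →
  countL differentResidues (hexNeighbours (suc a) (suc b)) ≡ 3
differingNeighbours a b
  rewrite residue-suc (suc a) | residue-suc a | residue-suc (suc b) | residue-suc b
  with residue a | residue b
... | r₀ | r₁ = λ _ → refl
... | r₀ | r₂ = λ _ → refl
... | r₁ | r₀ = λ _ → refl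
... | r₁ | r₂ = λ _ → refl
... | r₂ | r₀ = λ _ → refl
... | r₂ | r₁ = λ _ → refl
... | r₀ | r₀ = λ ()
... | r₁ | r₁ = λ ()
... | r₂ | r₂ = λ ()

<ᵇ-irrefl : ∀ x → (x <ᵇ x) ≡ false
<ᵇ-irrefl zero    = refl
<ᵇ-irrefl (suc x) = <ᵇ-irrefl x

countBelow-false : ∀ f k → (∀ x → f x ≡ false) → countBelow f k ≡ 0
countBelow-false f zero    f≡false = refl
countBelow-false f (suc k) f≡false rewrite f≡false k | countBelow-false f k f≡false = refl

module Construction (k : ℕ) where

  side : ℕ
  side = 2 + k * 3

  interior : ℕ → Bool
  interior x = (0 <ᵇ x) ∧ (x <ᵇ suc (k * 3))

  S : VSet
  S a b = interior a ∧ (interior b ∧ differ (residue a) (residue b))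

  open Region side side

  ∈S : ∀ {a b} → T (S a b) → T (interior a) × T (interior b) × T (differ (residue a) (residue b))
  ∈S {a} {b} a∈S with to (T-∧ {interior a}) a∈S
  ... | a-interior , rest = a-interior , to (T-∧ {interior b}) rest

  S⊆differentResidues : ∀ xy → T (inRegion side side xy ∧ S (proj₁ xy) (proj₂ xy)) → T (differentResidues xy)
  S⊆differentResidues (x , y) xy∈S =
    proj₂ (proj₂ (∈S {x} {y} (proj₂ (to (T-∧ {inRegion side side (x , y)}) xy∈S))))

  halfDependent : HalfDependent side side S
  halfDependent zero    b       _ _ ()
  halfDependent (suc a) zero    _ _ a∈S = ⊥-elim (proj₁ (proj₂ (∈S {suc a} {0} (from T-≡ a∈S))))
  halfDependent (suc a) (suc b) _ _ a∈S with ∈S {suc a} {suc b} (from T-≡ a∈S)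
  ... | a-interior , b-interior , different = begin
    nbrsIn side side S (suc a) (suc b)
      ≤⟨ countL-mono S⊆differentResidues (hexNeighbours (suc a) (suc b)) ⟩
    countL differentResidues (hexNeighbours (suc a) (suc b))
      ≡⟨ differingNeighbours a b different ⟩
    6 / 2
      ≡⟨ cong (_/ 2) (degree-interior (s≤s (s≤s a<3k)) (s≤s (s≤s b<3k))) ⟨
    degree side side (suc a) (suc b) / 2 ∎
    where
    open ≤-Reasoning
    a<3k : a < k * 3
    b<3k : b < k * 3
    a<3k = <ᵇ⇒< a (k * 3) a-interior
    b<3k = <ᵇ⇒< b (k * 3) b-interior

  row-count : ∀ ρ → sumBelow (λ b → indicator (interior b ∧ differ ρ (residue b))) side ≡ k * 2
  row-count ρ = begin
    sumBelow row side
      ≡⟨ sumBelow-interior row (k * 3) refl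
           (cong (λ t → indicator (t ∧ differ ρ (residue (suc (k * 3))))) (<ᵇ-irrefl (k * 3))) ⟩
    sumBelow (row ∘ suc) (k * 3)
      ≡⟨ sumBelow-cong (k * 3) (λ b b<3k →
           cong (λ t → indicator (t ∧ differ ρ (residue (suc b)))) (to T-≡ (<⇒<ᵇ b<3k))) ⟩
    sumBelow (λ b → indicator (differ ρ (residue (suc b)))) (k * 3)
      ≡⟨ sumBelow-cong (k * 3) (λ b _ → cong (indicator ∘ differ ρ) (residue-suc b)) ⟩
    sumBelow ((λ r → indicator (differ ρ (next r))) ∘ residue) (k * 3)
      ≡⟨ sumBelow-residue (λ r → indicator (differ ρ (next r))) k ⟩
    k * (indicator (differ ρ r₁) + indicator (differ ρ r₂) + indicator (differ ρ r₀))
      ≡⟨ cong (k *_) (two-of-three ρ) ⟩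
    k * 2 ∎
    where
    open ≡-Reasoning
    row : ℕ → ℕ
    row b = indicator (interior b ∧ differ ρ (residue b))
    two-of-three : ∀ ρ → indicator (differ ρ r₁) + indicator (differ ρ r₂) + indicator (differ ρ r₀) ≡ 2
    two-of-three r₀ = refl
    two-of-three r₁ = refl
    two-of-three r₂ = refl

  card-S : card side side S ≡ k * 3 * (k * 2)
  card-S = begin
    card side side S
      ≡⟨ card-sumBelow side side S ⟩
    sumBelow (λ a → countBelow (S a) side) side
      ≡⟨ sumBelow-interior _ (k * 3) (countBelow-false (S 0) side (λ _ → refl))
           (countBelow-false (S (suc (k * 3))) side (λ b →
             cong (_∧ (interior b ∧ differ (residue (suc (k * 3))) (residue b))) (<ᵇ-irrefl (k * 3)))) ⟩
    sumBelow (λ a → countBelow (S (suc a)) side) (k * 3)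
      ≡⟨ sumBelow-cong (k * 3) (λ a a<3k → interior-column a (to T-≡ (<⇒<ᵇ a<3k))) ⟩
    sumBelow (λ _ → k * 2) (k * 3)
      ≡⟨ sumBelow-const (k * 2) (k * 3) ⟩
    k * 3 * (k * 2) ∎
    where
    open ≡-Reasoning
    interior-column : ∀ a → interior (suc a) ≡ true → countBelow (S (suc a)) side ≡ k * 2
    interior-column a a-interior rewrite countBelow-sumBelow (S (suc a)) side | a-interior =
      row-count (residue (suc a))

density-upper-arith : ∀ {c m n D P} → 9 * c ≤ 6 * (m * n) + 4 * (m + n) → D ≤ m → D ≤ n → 1 ≤ P →
  c * (3 * D) ≤ (2 * D + P * 3) * (m * n)
density-upper-arith {c} {m} {n} {D} {P} nine-c D≤m D≤n 1≤P = *-cancelˡ-≤ 3 $ begin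
  3 * (c * (3 * D))
    ≡⟨ e₁ c D ⟩
  D * (9 * c)
    ≤⟨ *-monoʳ-≤ D nine-c ⟩
  D * (6 * (m * n) + 4 * (m + n))
    ≡⟨ e₂ D m n ⟩
  6 * (D * (m * n)) + 4 * (D * m) + 4 * (D * n)
    ≤⟨ +-mono-≤ (+-monoʳ-≤ (6 * (D * (m * n))) (*-monoʳ-≤ 4 (*-monoˡ-≤ m D≤n)))
                (*-monoʳ-≤ 4 (*-monoˡ-≤ n D≤m)) ⟩
  6 * (D * (m * n)) + 4 * (n * m) + 4 * (m * n)
    ≡⟨ e₃ D m n ⟩
  6 * (D * (m * n)) + 8 * (m * n)
    ≤⟨ +-monoʳ-≤ (6 * (D * (m * n))) (*-monoˡ-≤ (m * n) (*-monoʳ-≤ 8 1≤P)) ⟩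
  6 * (D * (m * n)) + 8 * P * (m * n)
    ≤⟨ +-monoʳ-≤ (6 * (D * (m * n))) (*-monoˡ-≤ (m * n) (*-monoˡ-≤ P (n≤1+n 8))) ⟩
  6 * (D * (m * n)) + 9 * P * (m * n)
    ≡⟨ e₄ D P m n ⟩
  3 * ((2 * D + P * 3) * (m * n)) ∎
  where
  open ≤-Reasoning
  e₁ : ∀ c D → 3 * (c * (3 * D)) ≡ D * (9 * c)
  e₁ = solve-∀
  e₂ : ∀ D m n → D * (6 * (m * n) + 4 * (m + n)) ≡ 6 * (D * (m * n)) + 4 * (D * m) + 4 * (D * n)
  e₂ = solve-∀
  e₃ : ∀ D m n → 6 * (D * (m * n)) + 4 * (n * m) + 4 * (m * n) ≡ 6 * (D * (m * n)) + 8 * (m * n)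
  e₃ = solve-∀
  e₄ : ∀ D P m n → 6 * (D * (m * n)) + 9 * P * (m * n) ≡ 3 * ((2 * D + P * 3) * (m * n))
  e₄ = solve-∀

density-lower-arith : ∀ {k D P} → D ≤ k → 1 ≤ P → let M = 2 + k * 3 in
  2 * D * (M * M) ≤ k * 3 * (k * 2) * (3 * D) + P * 3 * (M * M)
density-lower-arith {k} {D} {P} D≤k 1≤P = begin
  2 * D * (M * M)
    ≡⟨ e₁ k D ⟩
  c * (3 * D) + (24 * (D * k) + 8 * D)
    ≤⟨ +-monoʳ-≤ (c * (3 * D)) (+-mono-≤ (*-monoʳ-≤ 24 (*-monoˡ-≤ k D≤k)) (*-monoʳ-≤ 8 D≤k)) ⟩
  c * (3 * D) + (24 * (k * k) + 8 * k)
    ≤⟨ +-monoʳ-≤ (c * (3 * D)) (subst (24 * (k * k) + 8 * k ≤_) (e₂ k) (m≤m+n _ _)) ⟩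
  c * (3 * D) + 3 * (M * M)
    ≤⟨ +-monoʳ-≤ (c * (3 * D)) (*-monoˡ-≤ (M * M) (*-monoˡ-≤ 3 1≤P)) ⟩
  c * (3 * D) + P * 3 * (M * M) ∎
  where
  open ≤-Reasoning
  M c : ℕ
  M = 2 + k * 3
  c = k * 3 * (k * 2)
  e₁ : ∀ k D → 2 * D * ((2 + k * 3) * (2 + k * 3)) ≡ k * 3 * (k * 2) * (3 * D) + (24 * (D * k) + 8 * D)
  e₁ = solve-∀
  e₂ : ∀ k → 24 * (k * k) + 8 * k + (3 * (k * k) + 28 * k + 12) ≡ 3 * ((2 + k * 3) * (2 + k * 3))
  e₂ = solve-∀

-- Densities

ι : ℕ → ℚ
ι c = (ℤ.+ c) ℚ./ 1

⅔ : ℚ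
⅔ = (ℤ.+ 2) ℚ./ 3

toℚᵘ-ι : ∀ c → toℚᵘ (ι c) ℚᵘ.≃ mkℚᵘ (ℤ.+ c) 0
toℚᵘ-ι c = ℚ.toℚᵘ-fromℚᵘ (mkℚᵘ (ℤ.+ c) 0)

toℚᵘ-*ι : ∀ q {u} K → toℚᵘ q ℚᵘ.≃ u → toℚᵘ (q ℚ.* ι K) ℚᵘ.≃ u ℚᵘ.* mkℚᵘ (ℤ.+ K) 0
toℚᵘ-*ι q K q≃u = ℚᵘ.≃-trans (ℚ.toℚᵘ-homo-* q (ι K)) (ℚᵘ.*-cong q≃u (toℚᵘ-ι K))

-- The order of ℚ is decided by cross-multiplying on an unnormalised representative u of q.
ι-≤-*ι : ∀ {q} u {c K} → toℚᵘ q ℚᵘ.≃ u →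
  ℤ.+ c ℤ.* ↧ u ℤ.≤ ↥ u ℤ.* ℤ.+ K → ι c ℚ.≤ q ℚ.* ι K
ι-≤-*ι {q} u@(mkℚᵘ _ _) {c} {K} q≃u h = ℚ.toℚᵘ-cancel-≤ $
  ℚᵘ.≤-respˡ-≃ (ℚᵘ.≃-sym (toℚᵘ-ι c)) $ ℚᵘ.≤-respʳ-≃ (ℚᵘ.≃-sym (toℚᵘ-*ι q K q≃u)) $
  *≤* (subst₂ ℤ._≤_ (cong ((ℤ.+ c ℤ.*_) ∘ ℤ.+_) (sym (*-identityʳ (ℚᵘ.↧ₙ u))))
                    (sym (ℤ.*-identityʳ _)) h)

*ι-≤-ι : ∀ {q} u {c K} → toℚᵘ q ℚᵘ.≃ u →
  ↥ u ℤ.* ℤ.+ K ℤ.≤ ℤ.+ c ℤ.* ↧ u → q ℚ.* ι K ℚ.≤ ι c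
*ι-≤-ι {q} u@(mkℚᵘ _ _) {c} {K} q≃u h = ℚ.toℚᵘ-cancel-≤ $
  ℚᵘ.≤-respʳ-≃ (ℚᵘ.≃-sym (toℚᵘ-ι c)) $ ℚᵘ.≤-respˡ-≃ (ℚᵘ.≃-sym (toℚᵘ-*ι q K q≃u)) $
  *≤* (subst₂ ℤ._≤_ (sym (ℤ.*-identityʳ _))
                    (cong ((ℤ.+ c ℤ.*_) ∘ ℤ.+_) (sym (*-identityʳ (ℚᵘ.↧ₙ u)))) h)

ι-≤-⅔+ : ∀ P d .(cop : Coprime P (suc d)) {c K} → c * (3 * suc d) ≤ (2 * suc d + P * 3) * K →
  ι c ℚ.≤ (⅔ ℚ.+ mkℚ (ℤ.+ P) d cop) ℚ.* ι K
ι-≤-⅔+ P d cop {c} {K} h = ι-≤-*ι _ {c} {K} (ℚ.toℚᵘ-homo-+ ⅔ (mkℚ (ℤ.+ P) d cop)) $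
  subst₂ ℤ._≤_ (ℤ.pos-* c (3 * suc d)) numerator (+≤+ h)
  where
  numerator : ℤ.+ ((2 * suc d + P * 3) * K) ≡ (ℤ.+ 2 ℤ.* ℤ.+ suc d ℤ.+ ℤ.+ P ℤ.* ℤ.+ 3) ℤ.* ℤ.+ K
  numerator = begin
    ℤ.+ ((2 * suc d + P * 3) * K)
      ≡⟨ ℤ.pos-* (2 * suc d + P * 3) K ⟩
    ℤ.+ (2 * suc d + P * 3) ℤ.* ℤ.+ K
      ≡⟨ cong (ℤ._* ℤ.+ K) (ℤ.pos-+ (2 * suc d) (P * 3)) ⟩
    (ℤ.+ (2 * suc d) ℤ.+ ℤ.+ (P * 3)) ℤ.* ℤ.+ K
      ≡⟨ cong (ℤ._* ℤ.+ K) (cong₂ ℤ._+_ (ℤ.pos-* 2 (suc d)) (ℤ.pos-* P 3)) ⟩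
    (ℤ.+ 2 ℤ.* ℤ.+ suc d ℤ.+ ℤ.+ P ℤ.* ℤ.+ 3) ℤ.* ℤ.+ K ∎
    where open ≡-Reasoning

⅔-*ι-≤-ι : ∀ P d .(cop : Coprime P (suc d)) {c K} → 2 * suc d * K ≤ c * (3 * suc d) + P * 3 * K →
  (⅔ ℚ.- mkℚ (ℤ.+ P) d cop) ℚ.* ι K ℚ.≤ ι c
⅔-*ι-≤-ι P d cop {c} {K} h = *ι-≤-ι _ {c} {K} toℚᵘ-⅔-ε $ begin
  (ℤ.+ 2 ℤ.* ℤ.+ suc d ℤ.+ ℤ.- ℤ.+ P ℤ.* ℤ.+ 3) ℤ.* ℤ.+ K
    ≡⟨ expand (ℤ.+ suc d) (ℤ.+ P) (ℤ.+ K) ⟩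
  ℤ.+ 2 ℤ.* ℤ.+ suc d ℤ.* ℤ.+ K ℤ.- ℤ.+ P ℤ.* ℤ.+ 3 ℤ.* ℤ.+ K
    ≡⟨ cong₂ ℤ._-_ (pos-*³ 2 (suc d) K) (pos-*³ P 3 K) ⟨
  ℤ.+ (2 * suc d * K) ℤ.- ℤ.+ (P * 3 * K)
    ≤⟨ ℤ.+-monoˡ-≤ (ℤ.- ℤ.+ (P * 3 * K)) (+≤+ h) ⟩
  ℤ.+ (c * (3 * suc d) + P * 3 * K) ℤ.- ℤ.+ (P * 3 * K)
    ≡⟨ cong (ℤ._- ℤ.+ (P * 3 * K)) (ℤ.pos-+ (c * (3 * suc d)) (P * 3 * K)) ⟩
  ℤ.+ (c * (3 * suc d)) ℤ.+ ℤ.+ (P * 3 * K) ℤ.- ℤ.+ (P * 3 * K)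
    ≡⟨ cancel (ℤ.+ (c * (3 * suc d))) (ℤ.+ (P * 3 * K)) ⟩
  ℤ.+ (c * (3 * suc d))
    ≡⟨ ℤ.pos-* c (3 * suc d) ⟩
  ℤ.+ c ℤ.* ℤ.+ (3 * suc d) ∎
  where
  open ℤ.≤-Reasoning
  ε : ℚ
  ε = mkℚ (ℤ.+ P) d cop
  toℚᵘ-⅔-ε : toℚᵘ (⅔ ℚ.- ε) ℚᵘ.≃ toℚᵘ ⅔ ℚᵘ.+ ℚᵘ.- toℚᵘ ε
  toℚᵘ-⅔-ε =
    ℚᵘ.≃-trans (ℚ.toℚᵘ-homo-+ ⅔ (ℚ.- ε)) (ℚᵘ.+-cong (ℚᵘ.≃-refl {toℚᵘ ⅔}) (ℚ.toℚᵘ-homo‿- ε))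
  expand : ∀ D P K →
    (ℤ.+ 2 ℤ.* D ℤ.+ ℤ.- P ℤ.* ℤ.+ 3) ℤ.* K ≡ ℤ.+ 2 ℤ.* D ℤ.* K ℤ.- P ℤ.* ℤ.+ 3 ℤ.* K
  expand = ℤ-Solver.solve-∀
  cancel : ∀ i j → i ℤ.+ j ℤ.- j ≡ i
  cancel = ℤ-Solver.solve-∀
  pos-*³ : ∀ x y z → ℤ.+ (x * y * z) ≡ ℤ.+ x ℤ.* ℤ.+ y ℤ.* ℤ.+ z
  pos-*³ x y z = trans (ℤ.pos-* (x * y) z) (cong (ℤ._* ℤ.+ z) (ℤ.pos-* x y))

-- Positive ε forces its numerator to be +[1+ p ], so the single clause is exhaustive.
density-upper-bound : (ε : ℚ) → ℚ.Positive ε → Σ ℕ (λ N → (m n : ℕ) → m ≥ N → n ≥ N → (S : VSet) →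
  HalfDependent m n S → ι (card m n S) ℚ.≤ (⅔ ℚ.+ ε) ℚ.* ι (m * n))
density-upper-bound (mkℚ +[1+ p ] d cop) _ = suc d , λ m n m≥N n≥N S hd →
  ι-≤-⅔+ (suc p) d cop {card m n S} {m * n}
    (density-upper-arith {c = card m n S} {P = suc p} (9card≤6mn+4[m+n] m n S hd) m≥N n≥N (s≤s z≤n))

density-lower-bound : (ε : ℚ) → ℚ.Positive ε → (N : ℕ) → Σ ℕ (λ m → Σ ℕ (λ n → m ≥ N × n ≥ N ×
  Σ VSet (λ S → HalfDependent m n S × (⅔ ℚ.- ε) ℚ.* ι (m * n) ℚ.≤ ι (card m n S))))
density-lower-bound (mkℚ +[1+ p ] d cop) _ N = side , side , side≥N , side≥N , S , halfDependent ,
  subst (λ c → (⅔ ℚ.- mkℚ +[1+ p ] d cop) ℚ.* ι (side * side) ℚ.≤ ι c) (sym card-S)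
    (⅔-*ι-≤-ι (suc p) d cop {k * 3 * (k * 2)} {side * side}
      (density-lower-arith {P = suc p} (m≤m+n (suc d) N) (s≤s z≤n)))
  where
  k : ℕ
  k = suc d + N
  open Construction k
  side≥N : side ≥ N
  side≥N = ≤-trans (m≤n+m N (suc d)) (≤-trans (m≤m*n k 3) (m≤n+m (k * 3) 2))

mainTheorem3 :
    ((ε : ℚ) → ℚ.Positive ε → Σ ℕ (λ N → (m n : ℕ) → m ≥ N → n ≥ N → (S : VSet) →
        HalfDependent m n S →
        (ℤ.+ card m n S) ℚ./ 1 ℚ.≤ ((ℤ.+ 2) ℚ./ 3 ℚ.+ ε) ℚ.* ((ℤ.+ (m * n)) ℚ./ 1)))
    × ((ε : ℚ) → ℚ.Positive ε → (N : ℕ) → Σ ℕ (λ m → Σ ℕ (λ n → m ≥ N × n ≥ N ×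
        Σ VSet (λ S → HalfDependent m n S ×
          ((ℤ.+ 2) ℚ./ 3 ℚ.- ε) ℚ.* ((ℤ.+ (m * n)) ℚ./ 1) ℚ.≤ (ℤ.+ card m n S) ℚ./ 1))))
mainTheorem3 = density-upper-bound , density-lower-bound
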